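{- Let $G$ be a formula, $DB$ a saturated database for $G$, $\Omega\subseteq\bar\Gamma$, and $C_1,C_2$ formulas with $C_1\lor C_2\in\mathrm{Sr}(G)$. If $DB\rhd\Omega\rightarrow_g C_1$ and $DB\rhd\Omega\rightarrow_g C_2$, then $DB\rhd\Omega\rightarrow_g C_1\lor C_2$.
   Context: Formulas are built from a countably infinite set $\mathcal{V}$ of propositional variables and $\bot$ using $\land,\lor,\supset$. Let $\mathcal{V}_\bot=\mathcal{V}\cup\{\bot\}$, $\mathcal{L}^{\supset}$ the set of formulas with main connective $\supset$. For a formula $G$, $\mathrm{Sl}(G)$ and $\mathrm{Sr}(G)$ are the smallest subsets of the subformulas of $G$ with: $G\in\mathrm{Sr}(G)$; $A\land B$ or $A\lor B$ in $\mathrm{Sl}(G)$ (resp. $\mathrm{Sr}(G)$) implies $A,B$ in $\mathrm{Sl}(G)$ (resp. $\mathrm{Sr}(G)$); $A\supset B\in\mathrm{Sl}(G)$ implies $B\in\mathrm{Sl}(G)$, $A\in\mathrm{Sr}(G)$; $A\supset B\in\mathrm{Sr}(G)$ implies $B\in\mathrm{Sr}(G)$, $A\in\mathrm{Sl}(G)$. $\mathrm{Cl}(\Gamma)$ is the smallest set containing $\Gamma$ such that if $X,Y\in\mathrm{Cl}(\Gamma)$ and $A$ is any formula then $X\land Y,A\lor X,X\lor A,A\supset X\in\mathrm{Cl}(\Gamma)$. $\mathbf{FRJ}(G)$: let $\bar\Gamma^{At}=\mathrm{Sl}(G)\cap\mathcal V$, $\bar\Gamma^{\supset}=\mathrm{Sl}(G)\cap\mathcal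 L^{\supset}$, $\bar\Gamma=\bar\Gamma^{At}\cup\bar\Gamma^{\supset}$. Sequents: regular $\Gamma\Rightarrow C$ ($\Gamma\subseteq\bar\Gamma$, $C\in\mathrm{Sr}(G)$), irregular $\Sigma;\Theta\rightarrow C$ ($\Sigma\cup\Theta\subseteq\bar\Gamma$, $C\in\mathrm{Sr}(G)$); conclusions always have right formula in $\mathrm{Sr}(G)$. Rules ($F\in\mathcal V_\bot$, $k\in\{1,2\}$): axioms $\bar\Gamma^{At}\setminus\{F\}\Rightarrow F$ and $\emptyset;(\bar\Gamma^{At}\setminus\{F\})\cup\bar\Gamma^{\supset}\rightarrow F$; ($\land$) $\Gamma\Rightarrow A_k/\Gamma\Rightarrow A_1\land A_2$ and $\Sigma;\Theta\rightarrow A_k/\Sigma;\Theta\rightarrow A_1\land A_2$; ($\lor$) $\Sigma_1;\Theta_1\rightarrow C_1$, $\Sigma_2;\Theta_2\rightarrow C_2 / \Sigma_1\cup\Sigma_2;\Theta_1\cap\Theta_2\rightarrow C_1\lor C_2$ if $\Sigma_1\subseteq\Sigma_2\cup\Theta_2$, $\Sigma_2\subseteq\Sigma_1\cup\Theta_1$; ($\supset_\in$) $\Gamma\Rightarrow B/\Gamma\Rightarrow A\supset B$ if $A\in\mathrm{Cl}(\Gamma)$, and $\Sigma;\Theta\cup\Lambda\rightarrow B/\Sigma\cup\Lambda;\Theta\rightarrow A\supset B$ if $\Theta\cap\Lambda=\emptyset$, $A\in\mathrm{Cl}(\Sigma\cup\Lambda)$ and no $\Lambda'\subsetneq\Lambda$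 has $A\in\mathrm{Cl}(\Sigma\cup\Lambda')$; ($\supset_{\notin}$) $\Gamma\Rightarrow B/\emptyset;\Theta\rightarrow A\supset B$ if $\Theta\subseteq\mathrm{Cl}(\Gamma)\cap\bar\Gamma$, $A\in\mathrm{Cl}(\Gamma)\setminus\mathrm{Cl}(\Theta)$ and every $\Theta'$ with $\Theta\subsetneq\Theta'\subseteq\mathrm{Cl}(\Gamma)\cap\bar\Gamma$ has $A\in\mathrm{Cl}(\Theta')$; join rules with premises $\Sigma_j;\Theta_j\rightarrow A_j$ ($1\le j\le n$, $n\ge1$): let $\Upsilon=\{A_1,\dots,A_n\}$, $\Sigma^{At}=\bigcup_j(\Sigma_j\cap\mathcal V)$, $\Sigma^{\supset}=\bigcup_j(\Sigma_j\cap\mathcal L^{\supset})$, $\Theta^{At}=\bigcap_j(\Theta_j\cap\mathcal V)$, $\Theta^{\supset}=\{Y\supset Z\in\bigcap_j(\Theta_j\cap\mathcal L^{\supset}):Y\in\Upsilon\}$, requiring $\Sigma_i\subseteq\Sigma_j\cup\Theta_j$ ($i\ne j$) and ($Y\supset Z\in\Sigma^{\supset}\Rightarrow Y\in\Upsilon$); ($\bowtie^{At}$) conclusion $\Sigma^{At}\cup(\Theta^{At}\setminus\{F\})\cup\Sigma^{\supset}\cup\Theta^{\supset}\Rightarrow F$, $F\in\mathcal V_\bot\setminus\Sigma^{At}$, where each $Y\in\Upsilon$ has some $Y\supset Z\in\mathrm{Sl}(G)$; ($\bowtie^{\lor}$) conclusion $\Sigma^{At}\cup\Theta^{At}\cup\Sigma^{\supset}\cup\Theta^{\supset}\Rightarrow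 C_1\lor C_2$, $\{C_1,C_2\}\subseteq\Upsilon$, where each $Y\in\Upsilon$ has some $Y\supset Z\in\mathrm{Sl}(G)$ or $Y\lor Z\in\mathrm{Sr}(G)$ or $Z\lor Y\in\mathrm{Sr}(G)$. Subsumption: $\sigma_1\sqsubseteq\sigma_2$ iff either $\sigma_1=\Gamma_1\Rightarrow C$, $\sigma_2=\Gamma_2\Rightarrow C$ with $\Gamma_1\subseteq\Gamma_2$, or $\sigma_1=\Sigma;\Theta_1\rightarrow C$, $\sigma_2=\Sigma;\Theta_2\rightarrow C$ with $\Theta_1\subseteq\Theta_2$. A database for $G$ is a set of $\mathbf{FRJ}(G)$-sequents each derivable in $\mathbf{FRJ}(G)$; it is saturated if for every derivable $\mathbf{FRJ}(G)$-sequent $\sigma$ it contains some $\sigma'$ with $\sigma\sqsubseteq\sigma'$. For $\Omega\subseteq\mathrm{Sl}(G)$ and $C\in\mathrm{Sr}(G)$, write $DB\rhd\Omega\rightarrow_g C$ iff $DB$ contains an irregular sequent $\Sigma;\Theta\rightarrow C$ with $\Sigma\subseteq\Omega\subseteq\Sigma\cup\Theta$. -}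

module Defs where

open import Level using (0ℓ)
open import Data.Nat using (ℕ; suc)
open import Data.Fin using (Fin)
open import Data.Product using (Σ; ∃; ∃-syntax; _×_; _,_)
open import Data.Sum using (_⊎_)
open import Data.Empty using (⊥)
open import Relation.Nullary using (¬_)
open import Relation.Binary.PropositionalEquality using (_≡_; _≢_)
open import Relation.Unary using (Pred; _∈_; _∉_; _⊆_; _⊂_; _≐_; _∪_; _∩_; _∖_; ∅; ｛_｝)

infixr 6 _∧_
infixr 5 _∨_
infixr 4 _⊃_

data Formula : Set where
  var : ℕ → Formula
  ⊥ᶠ  : Formula
  _∧_ : Formula → Formula → Formula
  _∨_ : Formula → Formula → Formula
  _⊃_ : Formula → Formula → Formula

FSet : Set₁
FSet = Pred Formula 0ℓ

IsVar : FSet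
IsVar A = ∃[ n ] A ≡ var n

IsVar⊥ : FSet
IsVar⊥ A = IsVar A ⊎ A ≡ ⊥ᶠ

IsImp : FSet
IsImp A = ∃[ B ] ∃[ C ] A ≡ (B ⊃ C)

mutual
  data Sl (G : Formula) : Formula → Set where
    sl-∧₁ : ∀ {A B} → Sl G (A ∧ B) → Sl G A
    sl-∧₂ : ∀ {A B} → Sl G (A ∧ B) → Sl G B
    sl-∨₁ : ∀ {A B} → Sl G (A ∨ B) → Sl G A
    sl-∨₂ : ∀ {A B} → Sl G (A ∨ B) → Sl G B
    sl-⊃  : ∀ {A B} → Sl G (A ⊃ B) → Sl G B
    sr-⊃  : ∀ {A B} → Sr G (A ⊃ B) → Sl G A

  data Sr (G : Formula) : Formula → Set where
    sr-G  : Sr G G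
    sr-∧₁ : ∀ {A B} → Sr G (A ∧ B) → Sr G A
    sr-∧₂ : ∀ {A B} → Sr G (A ∧ B) → Sr G B
    sr-∨₁ : ∀ {A B} → Sr G (A ∨ B) → Sr G A
    sr-∨₂ : ∀ {A B} → Sr G (A ∨ B) → Sr G B
    sr-⊃' : ∀ {A B} → Sr G (A ⊃ B) → Sr G B
    sl-⊃' : ∀ {A B} → Sl G (A ⊃ B) → Sr G A

data Cl (Γ : FSet) : Formula → Set where
  cl-base : ∀ {X} → Γ X → Cl Γ X
  cl-∧    : ∀ {X Y} → Cl Γ X → Cl Γ Y → Cl Γ (X ∧ Y)
  cl-∨l   : ∀ {X} A → Cl Γ X → Cl Γ (A ∨ X)
  cl-∨r   : ∀ {X} A → Cl Γ X → Cl Γ (X ∨ A)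
  cl-⊃    : ∀ {X} A → Cl Γ X → Cl Γ (A ⊃ X)

ΓAt : Formula → FSet
ΓAt G = Sl G ∩ IsVar

Γ⊃ : Formula → FSet
Γ⊃ G = Sl G ∩ IsImp

Γbar : Formula → FSet
Γbar G = ΓAt G ∪ Γ⊃ G

-- Sequents: regular  Γ ⇒ C  and irregular  Σ ; Θ → C

data Sequent : Set₁ where
  reg : FSet → Formula → Sequent
  irr : FSet → FSet → Formula → Sequent

IsFRJSequent : Formula → Sequent → Set
IsFRJSequent G (reg Γ C)   = Γ ⊆ Γbar G × Sr G C
IsFRJSequent G (irr Σ Θ C) = (Σ ∪ Θ) ⊆ Γbar G × Sr G C

-- data of the premises of a join rule: n = suc m premises Σⱼ;Θⱼ → Aⱼ
module Join {m : ℕ} (Σs Θs : Fin (suc m) → FSet) (As : Fin (suc m) → Formula) where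
  Υ : FSet
  Υ Y = ∃[ j ] As j ≡ Y

  ΣAt : FSet
  ΣAt X = ∃[ j ] Σs j X × IsVar X

  Σ⊃ : FSet
  Σ⊃ X = ∃[ j ] Σs j X × IsImp X

  ΘAt : FSet
  ΘAt X = (∀ j → Θs j X) × IsVar X

  Θ⊃ : FSet
  Θ⊃ X = ∃[ Y ] ∃[ Z ] X ≡ (Y ⊃ Z) × (∀ j → Θs j X) × Υ Y

  JoinCond : Set
  JoinCond = (∀ i j → i ≢ j → Σs i ⊆ (Σs j ∪ Θs j))
           × (∀ Y Z → Σ⊃ (Y ⊃ Z) → Υ Y)

data FRJ (G : Formula) : Sequent → Set₁ where
  ax-reg : ∀ F → IsVar⊥ F → Sr G F →
           FRJ G (reg (ΓAt G ∖ ｛ F ｝) F)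
  ax-irr : ∀ F → IsVar⊥ F → Sr G F →
           FRJ G (irr ∅ ((ΓAt G ∖ ｛ F ｝) ∪ Γ⊃ G) F)
  ∧-reg  : ∀ {Γ A₁ A₂} (k : Formula) → (k ≡ A₁ ⊎ k ≡ A₂) → Sr G (A₁ ∧ A₂) →
           FRJ G (reg Γ k) → FRJ G (reg Γ (A₁ ∧ A₂))
  ∧-irr  : ∀ {Σ Θ A₁ A₂} (k : Formula) → (k ≡ A₁ ⊎ k ≡ A₂) → Sr G (A₁ ∧ A₂) →
           FRJ G (irr Σ Θ k) → FRJ G (irr Σ Θ (A₁ ∧ A₂))
  ∨-irr  : ∀ {Σ₁ Θ₁ C₁ Σ₂ Θ₂ C₂} → Sr G (C₁ ∨ C₂) →
           Σ₁ ⊆ (Σ₂ ∪ Θ₂) → Σ₂ ⊆ (Σ₁ ∪ Θ₁) →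
           FRJ G (irr Σ₁ Θ₁ C₁) → FRJ G (irr Σ₂ Θ₂ C₂) →
           FRJ G (irr (Σ₁ ∪ Σ₂) (Θ₁ ∩ Θ₂) (C₁ ∨ C₂))
  ⊃∈-reg : ∀ {Γ A B} → Sr G (A ⊃ B) → Cl Γ A →
           FRJ G (reg Γ B) → FRJ G (reg Γ (A ⊃ B))
  ⊃∈-irr : ∀ {Σ Θ A B} (Λ : FSet) → Sr G (A ⊃ B) →
           (∀ {X} → Θ X → Λ X → ⊥) →
           Cl (Σ ∪ Λ) A →
           (∀ (Λ′ : FSet) → Λ′ ⊂ Λ → ¬ Cl (Σ ∪ Λ′) A) →
           FRJ G (irr Σ (Θ ∪ Λ) B) → FRJ G (irr (Σ ∪ Λ) Θ (A ⊃ B))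
  ⊃∉     : ∀ {Γ A B} (Θ : FSet) → Sr G (A ⊃ B) →
           Θ ⊆ (Cl Γ ∩ Γbar G) →
           Cl Γ A → ¬ Cl Θ A →
           (∀ (Θ′ : FSet) → Θ ⊂ Θ′ → Θ′ ⊆ (Cl Γ ∩ Γbar G) → Cl Θ′ A) →
           FRJ G (reg Γ B) → FRJ G (irr ∅ Θ (A ⊃ B))
  ⋈At    : ∀ {m} (Σs Θs : Fin (suc m) → FSet) (As : Fin (suc m) → Formula) (F : Formula) →
           (∀ j → FRJ G (irr (Σs j) (Θs j) (As j))) →
           Join.JoinCond Σs Θs As →
           IsVar⊥ F → ¬ Join.ΣAt Σs Θs As F → Sr G F →
           (∀ Y → Join.Υ Σs Θs As Y → ∃[ Z ] Sl G (Y ⊃ Z)) →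
           FRJ G (reg (Join.ΣAt Σs Θs As ∪ (Join.ΘAt Σs Θs As ∖ ｛ F ｝)
                       ∪ Join.Σ⊃ Σs Θs As ∪ Join.Θ⊃ Σs Θs As) F)
  ⋈∨     : ∀ {m} (Σs Θs : Fin (suc m) → FSet) (As : Fin (suc m) → Formula) (C₁ C₂ : Formula) →
           (∀ j → FRJ G (irr (Σs j) (Θs j) (As j))) →
           Join.JoinCond Σs Θs As →
           Join.Υ Σs Θs As C₁ → Join.Υ Σs Θs As C₂ → Sr G (C₁ ∨ C₂) →
           (∀ Y → Join.Υ Σs Θs As Y →
              (∃[ Z ] Sl G (Y ⊃ Z)) ⊎ (∃[ Z ] Sr G (Y ∨ Z)) ⊎ (∃[ Z ] Sr G (Z ∨ Y))) →
           FRJ G (reg (Join.ΣAt Σs Θs As ∪ Join.ΘAt Σs Θs As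
                       ∪ Join.Σ⊃ Σs Θs As ∪ Join.Θ⊃ Σs Θs As) (C₁ ∨ C₂))

_⊑_ : Sequent → Sequent → Set
reg Γ₁ C₁    ⊑ reg Γ₂ C₂    = Γ₁ ⊆ Γ₂ × C₁ ≡ C₂
reg _ _      ⊑ irr _ _ _    = ⊥
irr _ _ _    ⊑ reg _ _      = ⊥
irr Σ₁ Θ₁ C₁ ⊑ irr Σ₂ Θ₂ C₂ = Σ₁ ≐ Σ₂ × Θ₁ ⊆ Θ₂ × C₁ ≡ C₂

SeqSet : Set₂
SeqSet = Pred Sequent (Level.suc 0ℓ)

IsDatabase : Formula → SeqSet → Set₁
IsDatabase G DB = ∀ σ → DB σ → IsFRJSequent G σ × FRJ G σ

IsSaturated : Formula → SeqSet → Set₁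
IsSaturated G DB = ∀ σ → FRJ G σ → ∃[ σ′ ] (DB σ′ × σ ⊑ σ′)

_▷_→g_ : SeqSet → FSet → Formula → Set₁
DB ▷ Ω →g C = ∃[ Σ′ ] ∃[ Θ ] (DB (irr Σ′ Θ C) × Σ′ ⊆ Ω × Ω ⊆ (Σ′ ∪ Θ))

{-# OPTIONS --safe #-}
module Submission where

open import Defs
open import Data.Product using (_,_; proj₂)
open import Data.Sum using (inj₁; inj₂)
open import Relation.Unary using (_⊆_; _∪_; _∩_)
open import Relation.Binary.PropositionalEquality using (refl)

-- Both queries are answered by irregular sequents of DB; the ∨-rule combines them into a
-- derivable sequent, saturation puts a sequent subsuming it into DB, and subsumption keeps
-- the left set and only enlarges the right one, so that sequent still answers the query.

∪-⊆ : ∀ {Σ₁ Σ₂ Ω : FSet} → Σ₁ ⊆ Ω → Σ₂ ⊆ Ω → Σ₁ ∪ Σ₂ ⊆ Ω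
∪-⊆ s₁ _ (inj₁ a) = s₁ a
∪-⊆ _ s₂ (inj₂ b) = s₂ b

⊆-∪-∩ : ∀ {Σ₁ Θ₁ Σ₂ Θ₂ Ω : FSet} → Ω ⊆ Σ₁ ∪ Θ₁ → Ω ⊆ Σ₂ ∪ Θ₂ →
        Ω ⊆ (Σ₁ ∪ Σ₂) ∪ (Θ₁ ∩ Θ₂)
⊆-∪-∩ o₁ o₂ w with o₁ w | o₂ w
... | inj₁ a | _      = inj₁ (inj₁ a)
... | inj₂ _ | inj₁ b = inj₁ (inj₂ b)
... | inj₂ a | inj₂ b = inj₂ (a , b)

▷-of-derivable : ∀ {G DB Ω Σ Θ C} → IsSaturated G DB → FRJ G (irr Σ Θ C) →
                 Σ ⊆ Ω → Ω ⊆ Σ ∪ Θ → DB ▷ Ω →g C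
▷-of-derivable {Ω = Ω} sat d s o with sat _ d
... | reg _ _ , _ , ()
... | irr Σ′ Θ′ _ , d′ , (Σ⊆Σ′ , Σ′⊆Σ) , Θ⊆Θ′ , refl =
  Σ′ , Θ′ , d′ , (λ x → s (Σ′⊆Σ x)) , Ω⊆Σ′∪Θ′
  where
  Ω⊆Σ′∪Θ′ : Ω ⊆ Σ′ ∪ Θ′
  Ω⊆Σ′∪Θ′ w with o w
  ... | inj₁ a = inj₁ (Σ⊆Σ′ a)
  ... | inj₂ b = inj₂ (Θ⊆Θ′ b)

lemma5p7 : (G : Formula) (DB : SeqSet) → IsDatabase G DB → IsSaturated G DB →
    (Ω : FSet) → Ω ⊆ Γbar G → (C₁ C₂ : Formula) → Sr G (C₁ ∨ C₂) →
    DB ▷ Ω →g C₁ → DB ▷ Ω →g C₂ → DB ▷ Ω →g (C₁ ∨ C₂)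
lemma5p7 G DB isDB sat Ω _ C₁ C₂ sr (Σ₁ , Θ₁ , d₁ , s₁ , o₁) (Σ₂ , Θ₂ , d₂ , s₂ , o₂) =
  ▷-of-derivable sat joined Σ₁∪Σ₂⊆Ω Ω⊆Σ₁∪Σ₂∪Θ₁∩Θ₂
  where
  Σ₁∪Σ₂⊆Ω : Σ₁ ∪ Σ₂ ⊆ Ω
  Σ₁∪Σ₂⊆Ω = ∪-⊆ {Σ₁} {Σ₂} s₁ s₂

  Ω⊆Σ₁∪Σ₂∪Θ₁∩Θ₂ : Ω ⊆ (Σ₁ ∪ Σ₂) ∪ (Θ₁ ∩ Θ₂)
  Ω⊆Σ₁∪Σ₂∪Θ₁∩Θ₂ = ⊆-∪-∩ {Σ₁} {Θ₁} {Σ₂} {Θ₂} o₁ o₂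

  joined : FRJ G (irr (Σ₁ ∪ Σ₂) (Θ₁ ∩ Θ₂) (C₁ ∨ C₂))
  joined = ∨-irr sr (λ x → o₂ (s₁ x)) (λ x → o₁ (s₂ x)) (proj₂ (isDB _ d₁)) (proj₂ (isDB _ d₂))
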